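{- $fsmp(G(3^2,3))=fmp(G(3^2,3))=3$.
   Context: The recursive circulant graph $G(9,3)=G(3^2,3)$ has vertex set $\{0,\dots,8\}$, with $u,v$ adjacent iff $u-v\equiv\pm1$ or $\pm3\pmod 9$. A fractional perfect matching of $G$ is $g:E(G)\to[0,1]$ with $\sum_{e\ni v}g(e)=1$ for all $v$. $fmp(G)$ (resp. $fsmp(G)$) is the minimum size of a set $F\subseteq E(G)$ (resp. $F\subseteq V(G)\cup E(G)$) whose deletion (vertices with incident edges, and edges) leaves a graph with no fractional perfect matching.
   Formalization: The fractional perfect matchings of the graphs left after deletion take rational values in $[0,1]$ rather than real ones. -}

module Defs where

open import Data.Bool using (Bool; true; false; T; _∧_; _∨_; not)
open import Data.Nat using (ℕ; _+_; _∸_; _≡ᵇ_; _<ᵇ_)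
open import Data.Nat.DivMod using (_%_)
open import Data.Fin using (Fin; toℕ)
open import Data.Fin.Properties using () renaming (_≟_ to _≟ᶠ_)
open import Data.Product using (Σ; _×_; _,_; proj₁; proj₂)
open import Data.Sum using (_⊎_; inj₁; inj₂)
open import Data.List using (List; []; _∷_; foldr; length; allFin)
open import Data.List.Membership.Propositional using (_∈_)
open import Data.List.Relation.Unary.Unique.Propositional using (Unique)
open import Data.Rational using (ℚ; 0ℚ; 1ℚ; _≤_) renaming (_+_ to _+ℚ_)
open import Relation.Nullary using (¬_; does)
open import Relation.Binary.PropositionalEquality using (_≡_)

-- The recursive circulant graph G(9,3) = G(3^2,3):
-- vertices 0..8, u ~ v iff u - v ≡ ±1 or ±3 (mod 9).
V : Set
V = Fin 9

diff9 : V → V → ℕ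
diff9 u v = (toℕ u + 9 ∸ toℕ v) % 9

adj : V → V → Bool
adj u v = let d = diff9 u v in (d ≡ᵇ 1) ∨ (d ≡ᵇ 8) ∨ (d ≡ᵇ 3) ∨ (d ≡ᵇ 6)

-- An edge is an unordered pair {u,v}, represented canonically as (u,v) with u < v.
isEdge : V × V → Bool
isEdge (u , v) = (toℕ u <ᵇ toℕ v) ∧ adj u v

Edge : Set
Edge = Σ (V × V) (λ p → T (isEdge p))

_∈ₑ_ : V → Edge → Bool
v ∈ₑ ((a , b) , _) = does (v ≟ᶠ a) ∨ does (v ≟ᶠ b)

edgesFrom : List (V × V) → List Edge
edgesFrom [] = []
edgesFrom (p ∷ ps) with Data.Bool.T? (isEdge p)
... | Relation.Nullary.yes t = (p , t) ∷ edgesFrom ps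
... | Relation.Nullary.no _ = edgesFrom ps

allPairs : List (V × V)
allPairs = Data.List.concatMap (λ u → Data.List.map (λ v → (u , v)) (allFin 9)) (allFin 9)

allEdges : List Edge
allEdges = edgesFrom allPairs

-- A deletion set F ⊆ V(G) ∪ E(G), given as a duplicate-free list.
Del : Set
Del = List (V ⊎ Edge)

VAlive : Del → V → Set
VAlive F v = ¬ (inj₁ v ∈ F)

EAlive : Del → Edge → Set
EAlive F e = ¬ (inj₂ e ∈ F) × VAlive F (proj₁ (proj₁ e)) × VAlive F (proj₂ (proj₁ e))

-- sum of g over the edges of G - F incident to v; the surviving edges are
-- exactly those of allEdges satisfying EAlive, deleted edges contribute via
-- the condition that g vanishes on them (see IsFPM).
incSum : (Edge → ℚ) → V → ℚ
incSum g v = foldr (λ e acc → (if v ∈ₑ e then g e else 0ℚ) +ℚ acc) 0ℚ allEdges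
  where open import Data.Bool using (if_then_else_)

IsFPM : Del → (Edge → ℚ) → Set
IsFPM F g =
  (∀ e → EAlive F e → (0ℚ ≤ g e) × (g e ≤ 1ℚ)) ×
  (∀ e → ¬ EAlive F e → g e ≡ 0ℚ) ×
  (∀ v → VAlive F v → incSum g v ≡ 1ℚ)

HasFPM : Del → Set
HasFPM F = Σ (Edge → ℚ) (IsFPM F)

EdgesOnly : Del → Set
EdgesOnly F = ∀ x → x ∈ F → Σ Edge (λ e → x ≡ inj₂ e)

FmpIs : ℕ → Set
FmpIs k =
  Σ Del (λ F → Unique F × EdgesOnly F × length F ≡ k × ¬ HasFPM F) ×
  (∀ F → Unique F → EdgesOnly F → ¬ HasFPM F → k Data.Nat.≤ length F)

FsmpIs : ℕ → Set
FsmpIs k =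
  Σ Del (λ F → Unique F × length F ≡ k × ¬ HasFPM F) ×
  (∀ F → Unique F → ¬ HasFPM F → k Data.Nat.≤ length F)

-- Upper bound: once the edges 01, 03 and 17 are deleted, S = {0,1,3,5,7} is an independent set whose
-- neighbours all lie in N = {2,4,6,8}. Summing the vertex constraints of a fractional perfect matching
-- over S and over N and double counting the edges gives |S| ≤ |N|, which is false.
-- Lower bound: whatever set of at most two vertices and edges is deleted, some rotation of one of seven
-- half-integral patterns (perfect matchings, and odd cycles carrying weight ½) survives the deletion
-- and is a fractional perfect matching of what is left. The finitely many cases are checked by evaluation.
module Submission where

open import Defs
open import Algebra.Bundles using (CommutativeMonoid)
open import Data.Bool using (true; false; T; T?; if_then_else_)
open import Data.Bool.Properties using (T-irrelevant)
open import Data.Empty using (⊥-elim)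
open import Data.Fin using (toℕ; #_)
open import Data.Fin.Properties using (_≟_) renaming (all? to allFin?)
open import Data.List using (List; []; _∷_; _++_; map; length; foldr; allFin; zipWith; drop; take)
open import Data.List.Membership.Propositional using (_∈_)
open import Data.List.Membership.Propositional.Properties
  using (∈-allFin; ∈-cartesianProduct⁺; ∈-map⁺; ∈-++⁺ˡ; ∈-++⁺ʳ)
open import Data.List.Relation.Unary.All as All using (All; []; _∷_; all?)
open import Data.List.Relation.Unary.All.Properties using (++⁺)
open import Data.List.Relation.Unary.AllPairs using ([]; _∷_)
open import Data.List.Relation.Unary.Any as Any using (Any; here; there; any?)
open import Data.List.Relation.Unary.Unique.Propositional using (Unique)
open import Data.Nat as ℕ using (ℕ; zero; suc; z≤n; s≤s; _<ᵇ_)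
open import Data.Nat.DivMod using (_mod_)
open import Data.Nat.ListAction using (sum)
open import Data.Nat.Properties using (≮⇒≥)
open import Data.Product using (_×_; _,_; proj₁; proj₂)
open import Data.Product.Properties using (≡-dec)
open import Data.Rational using (ℚ; 0ℚ; 1ℚ; ½; _+_; _≤_)
open import Data.Rational.Properties
  using (+-0-monoid; +-0-commutativeMonoid; +-identityˡ; +-identityʳ; +-mono-≤; +-monoʳ-≤; +-monoˡ-<;
         ≤-refl; ≤-reflexive; <⇒≤; <-irrefl; positive⁻¹; module ≤-Reasoning)
open import Data.Sum using (_⊎_; inj₁; inj₂)
import Data.Sum.Properties as Sum
open import Relation.Binary using (DecidableEquality)
open import Relation.Binary.PropositionalEquality
  using (_≡_; refl; sym; trans; cong; cong₂; module ≡-Reasoning)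
open import Relation.Nullary using (¬_; Dec; yes; no; does; ¬?; _×-dec_; _⊎-dec_; _→-dec_)
open import Relation.Nullary.Decidable using (toWitness; map′)

open import Algebra.Properties.Monoid.Mult +-0-monoid using (×-homo-+) renaming (_×_ to _·_)
open import Algebra.Properties.CommutativeSemigroup
  (CommutativeMonoid.commutativeSemigroup +-0-commutativeMonoid) using (interchange)

∑ : {A : Set} → List A → (A → ℚ) → ℚ
∑ xs f = foldr (λ x acc → f x + acc) 0ℚ xs

module _ {A : Set} where

  ∑-cong : ∀ xs {f h : A → ℚ} → All (λ x → f x ≡ h x) xs → ∑ xs f ≡ ∑ xs h
  ∑-cong []       []              = refl
  ∑-cong (x ∷ xs) (fx≡hx ∷ f≡h) = cong₂ _+_ fx≡hx (∑-cong xs f≡h)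

  ∑-mono-≤ : ∀ xs {f h : A → ℚ} → All (λ x → f x ≤ h x) xs → ∑ xs f ≤ ∑ xs h
  ∑-mono-≤ []       []              = ≤-refl
  ∑-mono-≤ (x ∷ xs) (fx≤hx ∷ f≤h) = +-mono-≤ fx≤hx (∑-mono-≤ xs f≤h)

  ∑-zero : ∀ (xs : List A) → ∑ xs (λ _ → 0ℚ) ≡ 0ℚ
  ∑-zero []       = refl
  ∑-zero (x ∷ xs) = trans (+-identityˡ _) (∑-zero xs)

  ∑-+ : ∀ xs (f h : A → ℚ) → ∑ xs (λ x → f x + h x) ≡ ∑ xs f + ∑ xs h
  ∑-+ []       f h = refl
  ∑-+ (x ∷ xs) f h =
    trans (cong (f x + h x +_) (∑-+ xs f h)) (interchange (f x) (h x) (∑ xs f) (∑ xs h))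

  ∑-const : ∀ xs q → ∑ xs (λ (_ : A) → q) ≡ length xs · q
  ∑-const []       q = refl
  ∑-const (x ∷ xs) q = cong (q +_) (∑-const xs q)

  ∑-· : ∀ xs (m : A → ℕ) q → ∑ xs (λ x → m x · q) ≡ sum (map m xs) · q
  ∑-· []       m q = refl
  ∑-· (x ∷ xs) m q =
    trans (cong (m x · q +_) (∑-· xs m q)) (sym (×-homo-+ q (m x) (sum (map m xs))))

  ∑-comm : {B : Set} (xs : List A) (ys : List B) (f : A → B → ℚ) →
           ∑ xs (λ x → ∑ ys (f x)) ≡ ∑ ys (λ y → ∑ xs (λ x → f x y))
  ∑-comm xs []       f = ∑-zero xs
  ∑-comm xs (y ∷ ys) f =
    trans (∑-+ xs (λ x → f x y) (λ x → ∑ ys (f x))) (cong (∑ xs (λ x → f x y) +_) (∑-comm xs ys f))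

·-zeroʳ : ∀ m → m · 0ℚ ≡ 0ℚ
·-zeroʳ zero    = refl
·-zeroʳ (suc m) = trans (+-identityˡ (m · 0ℚ)) (·-zeroʳ m)

·-monoˡ-≤ : ∀ q → 0ℚ ≤ q → ∀ {m n} → m ℕ.≤ n → m · q ≤ n · q
·-monoˡ-≤ q 0≤q {n = zero}  z≤n       = ≤-refl
·-monoˡ-≤ q 0≤q {n = suc n} z≤n       = +-mono-≤ 0≤q (·-monoˡ-≤ q 0≤q {n = n} z≤n)
·-monoˡ-≤ q 0≤q             (s≤s m≤n) = +-monoʳ-≤ q (·-monoˡ-≤ q 0≤q m≤n)

incident : (Edge → ℚ) → V → Edge → ℚ
incident g v e = if v ∈ₑ e then g e else 0ℚ

endpointsIn : List V → Edge → ℕ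
endpointsIn S e = sum (map (λ v → if v ∈ₑ e then 1 else 0) S)

∑-incident : ∀ S g e → ∑ S (λ v → incident g v e) ≡ endpointsIn S e · g e
∑-incident S g e = trans (∑-cong S (All.universal indicator S)) (∑-· S _ (g e))
  where
  indicator : ∀ v → incident g v e ≡ (if v ∈ₑ e then 1 else 0) · g e
  indicator v with v ∈ₑ e
  ... | true  = sym (+-identityʳ (g e))
  ... | false = refl

∑-incSum : ∀ S g → ∑ S (incSum g) ≡ ∑ allEdges (λ e → endpointsIn S e · g e)
∑-incSum S g =
  trans (∑-comm S allEdges (incident g)) (∑-cong allEdges (All.universal (∑-incident S g) allEdges))

degree : (Edge → ℕ) → V → ℕ
degree m v = sum (map (λ e → if v ∈ₑ e then m e else 0) allEdges)

incSum-· : ∀ (m : Edge → ℕ) q v → incSum (λ e → m e · q) v ≡ degree m v · q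
incSum-· m q v =
  trans (∑-cong allEdges (All.universal indicator allEdges))
        (∑-· allEdges (λ e → if v ∈ₑ e then m e else 0) q)
  where
  indicator : ∀ e → incident (λ e → m e · q) v e ≡ (if v ∈ₑ e then m e else 0) · q
  indicator e with v ∈ₑ e
  ... | true  = refl
  ... | false = refl

_≟ₚ_ : DecidableEquality (V × V)
_≟ₚ_ = ≡-dec _≟_ _≟_

_≟ₑ_ : DecidableEquality Edge
_≟ₑ_ = ≡-dec _≟ₚ_ (λ s t → yes (T-irrelevant s t))

open import Data.List.Membership.DecPropositional (Sum.≡-dec (_≟_ {n = 9}) _≟ₑ_) using (_∈?_)
open import Data.List.Membership.DecPropositional (_≟_ {n = 9}) using () renaming (_∈?_ to _∈ᵥ?_)

vAlive? : ∀ F v → Dec (VAlive F v)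
vAlive? F v = ¬? (inj₁ v ∈? F)

eAlive? : ∀ F e → Dec (EAlive F e)
eAlive? F e@((u , w) , _) = ¬? (inj₂ e ∈? F) ×-dec vAlive? F u ×-dec vAlive? F w

IsFPM-endpoints-≤ : ∀ {F g} S N → IsFPM F g → ∀ {e} →
                    (EAlive F e → endpointsIn S e ℕ.≤ endpointsIn N e) →
                    endpointsIn S e · g e ≤ endpointsIn N e · g e
IsFPM-endpoints-≤ {F} {g} S N (bounded , vanishes , _) {e} fewer with eAlive? F e
... | yes alive = ·-monoˡ-≤ (g e) (proj₁ (bounded e alive)) (fewer alive)
... | no dead   = ≤-reflexive (begin
  endpointsIn S e · g e  ≡⟨ cong (endpointsIn S e ·_) (vanishes e dead) ⟩
  endpointsIn S e · 0ℚ   ≡⟨ ·-zeroʳ (endpointsIn S e) ⟩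
  0ℚ                     ≡⟨ sym (·-zeroʳ (endpointsIn N e)) ⟩
  endpointsIn N e · 0ℚ   ≡⟨ cong (endpointsIn N e ·_) (sym (vanishes e dead)) ⟩
  endpointsIn N e · g e  ∎)
  where open ≡-Reasoning

deficient⇒¬HasFPM : ∀ F (S N : List V) → All (VAlive F) S → All (VAlive F) N →
                    All (λ e → EAlive F e → endpointsIn S e ℕ.≤ endpointsIn N e) allEdges →
                    length N ℕ.< length S → ¬ HasFPM F
deficient⇒¬HasFPM F S N aliveS aliveN fewer N<S (g , fpm@(_ , _ , sums≡1)) = <-irrefl refl (begin-strict
  length N · 1ℚ                             ≡⟨ sym (+-identityˡ _) ⟩
  0ℚ + length N · 1ℚ                        <⟨ +-monoˡ-< (length N · 1ℚ) (positive⁻¹ 1ℚ) ⟩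
  suc (length N) · 1ℚ                       ≤⟨ ·-monoˡ-≤ 1ℚ (<⇒≤ (positive⁻¹ 1ℚ)) N<S ⟩
  length S · 1ℚ                             ≡⟨ sym (∑-const S 1ℚ) ⟩
  ∑ S (λ _ → 1ℚ)                            ≡⟨ sym (∑-cong S (All.map (sums≡1 _) aliveS)) ⟩
  ∑ S (incSum g)                            ≡⟨ ∑-incSum S g ⟩
  ∑ allEdges (λ e → endpointsIn S e · g e)  ≤⟨ ∑-mono-≤ allEdges (All.map (IsFPM-endpoints-≤ S N fpm) fewer) ⟩
  ∑ allEdges (λ e → endpointsIn N e · g e)  ≡⟨ sym (∑-incSum N g) ⟩
  ∑ N (incSum g)                            ≡⟨ ∑-cong N (All.map (sums≡1 _) aliveN) ⟩
  ∑ N (λ _ → 1ℚ)                            ≡⟨ ∑-const N 1ℚ ⟩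
  length N · 1ℚ                             ∎)
  where open ≤-Reasoning

F₀ : Del
F₀ = inj₂ ((# 0 , # 1) , _) ∷ inj₂ ((# 0 , # 3) , _) ∷ inj₂ ((# 1 , # 7) , _) ∷ []

F₀-unique : Unique F₀
F₀-unique = ((λ ()) ∷ (λ ()) ∷ []) ∷ ((λ ()) ∷ []) ∷ [] ∷ []

F₀-edgesOnly : EdgesOnly F₀
F₀-edgesOnly _ (here refl)                 = _ , refl
F₀-edgesOnly _ (there (here refl))         = _ , refl
F₀-edgesOnly _ (there (there (here refl))) = _ , refl

F₀-keeps-vertices : ∀ v → VAlive F₀ v
F₀-keeps-vertices v (here ())
F₀-keeps-vertices v (there (here ()))
F₀-keeps-vertices v (there (there (here ())))
F₀-keeps-vertices v (there (there (there ())))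

¬HasFPM-F₀ : ¬ HasFPM F₀
¬HasFPM-F₀ = deficient⇒¬HasFPM F₀ S N
  (All.universal F₀-keeps-vertices S) (All.universal F₀-keeps-vertices N)
  (toWitness {a? = all? (λ e → eAlive? F₀ e →-dec (endpointsIn S e ℕ.≤? endpointsIn N e)) allEdges} _)
  (s≤s (s≤s (s≤s (s≤s (s≤s z≤n)))))
  where
  S N : List V
  S = # 0 ∷ # 1 ∷ # 3 ∷ # 5 ∷ # 7 ∷ []
  N = # 2 ∷ # 4 ∷ # 6 ∷ # 8 ∷ []

∈-edgesFrom : ∀ {p} ps (t : T (isEdge p)) → p ∈ ps → (p , t) ∈ edgesFrom ps
∈-edgesFrom (q ∷ ps) t (here refl) with T? (isEdge q)
... | yes t′ = here (cong (q ,_) (T-irrelevant t t′))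
... | no ¬t  = ⊥-elim (¬t t)
∈-edgesFrom (q ∷ ps) t (there p∈ps) with T? (isEdge q)
... | yes _ = there (∈-edgesFrom ps t p∈ps)
... | no _  = ∈-edgesFrom ps t p∈ps

∈-allEdges : ∀ e → e ∈ allEdges
∈-allEdges ((u , v) , t) = ∈-edgesFrom allPairs t (∈-cartesianProduct⁺ (∈-allFin u) (∈-allFin v))

items : List (V ⊎ Edge)
items = map inj₁ (allFin 9) ++ map inj₂ allEdges

∈-items : ∀ x → x ∈ items
∈-items (inj₁ v) = ∈-++⁺ˡ (∈-map⁺ inj₁ (∈-allFin v))
∈-items (inj₂ e) = ∈-++⁺ʳ (map inj₁ (allFin 9)) (∈-map⁺ inj₂ (∈-allEdges e))

allItems? : {P : V ⊎ Edge → Set} → (∀ x → Dec (P x)) → Dec (∀ x → P x)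
allItems? P? =
  map′ (λ all x → All.lookup all (∈-items x)) (λ ∀P → All.tabulate (λ {x} _ → ∀P x)) (all? P? items)

-- A support entry ((u , v) , m) with u < v puts the weight m · ½ on the edge uv.
record Weighting : Set where
  field
    support   : List ((V × V) × ℕ)
    uncovered : List V
open Weighting

multiplicity : List ((V × V) × ℕ) → Edge → ℕ
multiplicity []            e = 0
multiplicity ((p , m) ∷ s) e = if does (proj₁ e ≟ₚ p) then m else multiplicity s e

weight : Weighting → Edge → ℚ
weight w e = multiplicity (support w) e · ½

IsPerfect : Weighting → Set
IsPerfect w = All (λ (_ , m) → m ℕ.≤ 2) (support w) ×
              (∀ v → v ∈ uncovered w ⊎ degree (multiplicity (support w)) v ≡ 2)

Removes : V ⊎ Edge → V × V → Set
Removes (inj₁ v) (a , b) = v ≡ a ⊎ v ≡ b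
Removes (inj₂ f) p       = proj₁ f ≡ p

Fits : Del → Weighting → Set
Fits F w = All (λ (p , _) → All (λ x → ¬ Removes x p) F) (support w) ×
           All (λ v → inj₁ v ∈ F) (uncovered w)

unremoved⇒EAlive : ∀ {F e} → All (λ x → ¬ Removes x (proj₁ e)) F → EAlive F e
unremoved⇒EAlive kept = (λ e∈F → All.lookup kept e∈F refl) ,
                        (λ u∈F → All.lookup kept u∈F (inj₁ refl)) ,
                        (λ v∈F → All.lookup kept v∈F (inj₂ refl))

multiplicity-≤ : ∀ {k} s → All (λ (_ , m) → m ℕ.≤ k) s → ∀ e → multiplicity s e ℕ.≤ k
multiplicity-≤ []            []         e = z≤n
multiplicity-≤ ((p , m) ∷ s) (m≤k ∷ ≤k) e with proj₁ e ≟ₚ p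
... | yes _ = m≤k
... | no _  = multiplicity-≤ s ≤k e

¬EAlive⇒multiplicity≡0 : ∀ {F e} s → All (λ (p , _) → All (λ x → ¬ Removes x p) F) s → ¬ EAlive F e →
                         multiplicity s e ≡ 0
¬EAlive⇒multiplicity≡0 []            []             dead = refl
¬EAlive⇒multiplicity≡0 {e = e} ((p , m) ∷ s) (kept ∷ kepts) dead with proj₁ e ≟ₚ p
... | yes refl = ⊥-elim (dead (unremoved⇒EAlive kept))
... | no _     = ¬EAlive⇒multiplicity≡0 s kepts dead

fits⇒IsFPM : ∀ {F w} → IsPerfect w → Fits F w → IsFPM F (weight w)
fits⇒IsFPM {F} {w} (≤2 , perfect) (kepts , deleted) = bounded , vanishes , covered
  where
  0≤½ : 0ℚ ≤ ½
  0≤½ = <⇒≤ (positive⁻¹ ½)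
  bounded : ∀ e → EAlive F e → 0ℚ ≤ weight w e × weight w e ≤ 1ℚ
  bounded e _ = ·-monoˡ-≤ ½ 0≤½ {n = multiplicity (support w) e} z≤n ,
                ·-monoˡ-≤ ½ 0≤½ (multiplicity-≤ (support w) ≤2 e)
  vanishes : ∀ e → ¬ EAlive F e → weight w e ≡ 0ℚ
  vanishes e dead = cong (_· ½) (¬EAlive⇒multiplicity≡0 (support w) kepts dead)
  covered : ∀ v → VAlive F v → incSum (weight w) v ≡ 1ℚ
  covered v alive with perfect v
  ... | inj₁ v∈uncovered = ⊥-elim (alive (All.lookup deleted v∈uncovered))
  ... | inj₂ degree≡2    = trans (incSum-· (multiplicity (support w)) ½ v) (cong (_· ½) degree≡2)

any-fits⇒HasFPM : ∀ {F ws} → All IsPerfect ws → Any (Fits F) ws → HasFPM F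
any-fits⇒HasFPM perfects fit = weight (Any.lookup fit) , fits⇒IsFPM (proj₁ found) (proj₂ found)
  where found = All.lookupAny perfects fit

removes? : ∀ x p → Dec (Removes x p)
removes? (inj₁ v) (a , b) = (v ≟ a) ⊎-dec (v ≟ b)
removes? (inj₂ f) p       = proj₁ f ≟ₚ p

fits? : ∀ F w → Dec (Fits F w)
fits? F w = all? (λ (p , _) → all? (λ x → ¬? (removes? x p)) F) (support w) ×-dec
            all? (λ v → inj₁ v ∈? F) (uncovered w)

perfect? : ∀ w → Dec (IsPerfect w)
perfect? w = all? (λ (_ , m) → m ℕ.≤? 2) (support w) ×-dec
             allFin? (λ v → (v ∈ᵥ? uncovered w) ⊎-dec (degree (multiplicity (support w)) v ℕ.≟ 2))

matching : List (ℕ × ℕ) → List (ℕ × ℕ × ℕ)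
matching = map (λ (a , b) → a , b , 2)

halfCycle : List ℕ → List (ℕ × ℕ × ℕ)
halfCycle vs = zipWith (λ a b → a , b , 1) vs (drop 1 vs ++ take 1 vs)

rotated : ℕ → List (ℕ × ℕ × ℕ) → List ℕ → Weighting
rotated k es us = record
  { support   = map (λ (a , b , m) → orient (shift a , shift b) , m) es
  ; uncovered = map shift us
  }
  where
  shift : ℕ → V
  shift a = (a ℕ.+ k) mod 9
  orient : V × V → V × V
  orient (u , v) = if toℕ u <ᵇ toℕ v then (u , v) else (v , u)

-- Their supports partition the edge set, so any two deleted edges miss one of them.
triangles : List Weighting
triangles = map (λ k → rotated k triangle []) (0 ∷ 1 ∷ 2 ∷ [])
  where triangle = halfCycle (0 ∷ 3 ∷ 6 ∷ []) ++ matching ((1 , 2) ∷ (4 , 5) ∷ (7 , 8) ∷ [])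

-- Two edge-disjoint perfect matchings of G − u (one of them avoids any deleted edge) and, for
-- d = 1, …, 4, a 7-cycle through G − {u, u + d}; every pair of vertices is {u, u + d} for such u and d.
anchoredAt : V → List Weighting
anchoredAt u = map (λ (es , us) → rotated (toℕ u) es us)
  ( (matching ((1 , 2) ∷ (3 , 4) ∷ (5 , 6) ∷ (7 , 8) ∷ []) , 0 ∷ [])
  ∷ (matching ((1 , 4) ∷ (2 , 3) ∷ (5 , 8) ∷ (6 , 7) ∷ []) , 0 ∷ [])
  ∷ (halfCycle (2 ∷ 3 ∷ 4 ∷ 5 ∷ 6 ∷ 7 ∷ 8 ∷ []) , 0 ∷ 1 ∷ [])
  ∷ (halfCycle (1 ∷ 4 ∷ 3 ∷ 6 ∷ 5 ∷ 8 ∷ 7 ∷ []) , 0 ∷ 2 ∷ [])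
  ∷ (halfCycle (1 ∷ 2 ∷ 8 ∷ 7 ∷ 6 ∷ 5 ∷ 4 ∷ []) , 0 ∷ 3 ∷ [])
  ∷ (halfCycle (1 ∷ 2 ∷ 3 ∷ 6 ∷ 5 ∷ 8 ∷ 7 ∷ []) , 0 ∷ 4 ∷ [])
  ∷ [])

candidates : V ⊎ Edge → V ⊎ Edge → List Weighting
candidates (inj₁ u) (inj₁ v) = anchoredAt u ++ anchoredAt v
candidates (inj₁ u) (inj₂ _) = anchoredAt u
candidates (inj₂ _) (inj₁ v) = anchoredAt v
candidates (inj₂ _) (inj₂ _) = triangles

triangles-perfect : All IsPerfect triangles
triangles-perfect = toWitness {a? = all? perfect? triangles} _

anchoredAt-perfect : ∀ u → All IsPerfect (anchoredAt u)
anchoredAt-perfect = toWitness {a? = allFin? (λ u → all? perfect? (anchoredAt u))} _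

candidates-perfect : ∀ x y → All IsPerfect (candidates x y)
candidates-perfect (inj₁ u) (inj₁ v) = ++⁺ (anchoredAt-perfect u) (anchoredAt-perfect v)
candidates-perfect (inj₁ u) (inj₂ _) = anchoredAt-perfect u
candidates-perfect (inj₂ _) (inj₁ v) = anchoredAt-perfect v
candidates-perfect (inj₂ _) (inj₂ _) = triangles-perfect

singletons-fit : ∀ x → Any (Fits (x ∷ [])) (candidates x x)
singletons-fit = toWitness {a? = allItems? (λ x → any? (fits? (x ∷ [])) (candidates x x))} _

pairs-fit : ∀ x y → Any (Fits (x ∷ y ∷ [])) (candidates x y)
pairs-fit =
  toWitness {a? = allItems? (λ x → allItems? (λ y → any? (fits? (x ∷ y ∷ [])) (candidates x y)))} _

length<3⇒HasFPM : ∀ F → length F ℕ.< 3 → HasFPM F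
length<3⇒HasFPM []              _ =
  any-fits⇒HasFPM triangles-perfect (toWitness {a? = any? (fits? []) triangles} _)
length<3⇒HasFPM (x ∷ [])        _ = any-fits⇒HasFPM (candidates-perfect x x) (singletons-fit x)
length<3⇒HasFPM (x ∷ y ∷ [])    _ = any-fits⇒HasFPM (candidates-perfect x y) (pairs-fit x y)
length<3⇒HasFPM (_ ∷ _ ∷ _ ∷ _) (s≤s (s≤s (s≤s ())))

lemma4p17 : FsmpIs 3 × FmpIs 3
lemma4p17 = ((F₀ , F₀-unique , refl , ¬HasFPM-F₀) , λ F _ → atLeast3 F) ,
            ((F₀ , F₀-unique , F₀-edgesOnly , refl , ¬HasFPM-F₀) , λ F _ _ → atLeast3 F)
  where
  atLeast3 : ∀ F → ¬ HasFPM F → 3 ℕ.≤ length F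
  atLeast3 F ¬fpm = ≮⇒≥ (λ F<3 → ¬fpm (length<3⇒HasFPM F F<3))
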